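{- Let $\ell \geq 4$ be an even integer, and let $\alpha \geq 1$ and $t \geq 1$ be integers. In $\mathbb{Z}$ define \[ I_1 = \{2\gamma + 1 : 0 \leq \gamma \leq \alpha\},\quad I_2 = \{2\alpha + 5 + 2\theta : 0 \leq \theta \leq t\},\quad I_3 = \{2\alpha + 4t + 9\}, \] and $S^+ = I_1 \cup I_2 \cup I_3$. If $\alpha \geq 2t + 2\ell - 2$ and $M = \ell(2\alpha + 4t + 9)$, then \[ \ell S^+ = [\ell, M]_e \setminus \big( [M - 2t - 2, M - 2]_e \cup \{ M - 4t - 6\} \big). \]
   Context: For a set $S \subseteq \mathbb{Z}$ and a positive integer $\ell$, $\ell S = \{s_1 + \dots + s_\ell : s_i \in S\}$ is the $\ell$-fold sumset (computed in $\mathbb{Z}$). For even integers $m_1 < m_2$, $[m_1, m_2]_e = \{m_1, m_1 + 2, m_1 + 4, \dots, m_2\}$ denotes the set of consecutive even integers from $m_1$ to $m_2$. -}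

module Defs where

open import Data.Nat using (ℕ; zero; suc)
open import Data.Integer using (ℤ; +_; _+_; _*_; _-_; _≤_)
open import Data.Product using (Σ; ∃; _×_; _,_)
open import Data.Sum using (_⊎_)
open import Data.Vec using (Vec; foldr)
open import Data.Vec.Relation.Unary.All using (All)
open import Relation.Binary.PropositionalEquality using (_≡_)
open import Relation.Nullary using (¬_)

sumV : ∀ {n} → Vec ℤ n → ℤ
sumV = foldr _ _+_ (+ 0)

SumSet : ℕ → (ℤ → Set) → ℤ → Set
SumSet ℓ S x = Σ (Vec ℤ ℓ) λ v → All S v × sumV v ≡ x

EvenInterval : ℤ → ℤ → ℤ → Set
EvenInterval m₁ m₂ x = (Σ ℕ λ k → x ≡ m₁ + (+ 2) * (+ k)) × (x ≤ m₂)

I₁ : ℕ → ℤ → Set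
I₁ α x = Σ ℕ λ γ → (γ Data.Nat.≤ α) × (x ≡ (+ 2) * (+ γ) + (+ 1))

I₂ : ℕ → ℕ → ℤ → Set
I₂ α t x = Σ ℕ λ θ → (θ Data.Nat.≤ t) × (x ≡ (+ 2) * (+ α) + (+ 5) + (+ 2) * (+ θ))

I₃ : ℕ → ℕ → ℤ → Set
I₃ α t x = x ≡ (+ 2) * (+ α) + (+ 4) * (+ t) + (+ 9)

S⁺ : ℕ → ℕ → ℤ → Set
S⁺ α t x = I₁ α x ⊎ I₂ α t x ⊎ I₃ α t x

Mval : ℕ → ℕ → ℕ → ℤ
Mval ℓ α t = (+ ℓ) * ((+ 2) * (+ α) + (+ 4) * (+ t) + (+ 9))

Target : ℕ → ℕ → ℕ → ℤ → Set
Target ℓ α t x =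
  EvenInterval (+ ℓ) M x ×
  ¬ (EvenInterval (M - (+ 2) * (+ t) - (+ 2)) (M - (+ 2)) x ⊎ x ≡ M - (+ 4) * (+ t) - (+ 6))
  where M = Mval ℓ α t

-- Every element of S⁺ is top − 2e with top = 2α + 4t + 9, and the gaps e that occur
-- are exactly the numbers e ≤ Q = α + 2t + 4 that are admissible: e = 0,
-- t + 2 ≤ e ≤ 2t + 2 or e ≥ 2t + 4.  Hence ℓS⁺ = {M − 2E : E a sum of ℓ gaps}.
-- Admissible numbers are closed under addition, and conversely every admissible
-- E ≤ ℓQ is a sum of ℓ gaps: peel off gaps Q greedily, and when the remainder E′
-- would be forbidden (1 ≤ E′ ≤ t + 1 or E′ = 2t + 3) peel off the gap α ≥ 2t + 4
-- instead, leaving the admissible 2t + 4 + E′ ≤ Q.  So ℓS⁺ consists of the M − 2E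
-- with 0 ≤ E ≤ ℓQ and E not forbidden, which is the right-hand side as M − 2ℓQ = ℓ.
module Submission where

open import Defs
open import Data.Nat using (ℕ; _≤_; _*_; _+_; _∸_)
open import Data.Nat.Divisibility using (_∣_)
open import Data.Integer using (ℤ)
open import Function.Bundles using (_⇔_)

open import Data.Nat using (zero; suc; z≤n; s≤s; _<_; _≤?_)
import Data.Nat.Properties as ℕ
open import Data.Nat.Tactic.RingSolver using (solve-∀)
open import Data.Integer as ℤ using (+_)
import Data.Integer.Properties as ℤ
import Data.Integer.Tactic.RingSolver as ℤ-Solver
open import Data.Product using (Σ-syntax; ∃-syntax; _×_; _,_)
open import Data.Vec using (Vec; []; _∷_; map; sum)
open import Data.Vec.Relation.Unary.All as All using (All; []; _∷_)
open import Data.Vec.Relation.Unary.All.Properties using (map⁺)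
open import Data.Sum using (_⊎_; inj₁; inj₂)
open import Data.Empty using (⊥-elim)
open import Relation.Binary.PropositionalEquality
open import Relation.Nullary using (¬_; yes; no)
open import Function.Base using (_∘_)
open import Function.Bundles using (mk⇔; Equivalence)

≤-slack : ∀ {m o} n → m + n ≡ o → m ≤ o
≤-slack n refl = ℕ.m≤m+n _ n

<-slack : ∀ {m o} n → m + suc n ≡ o → m < o
<-slack n refl = ℕ.m<m+n _ (s≤s z≤n)

infixl 6 _↓_
_↓_ : ℤ → ℕ → ℤ
M ↓ n = M ℤ.- (+ 2) ℤ.* (+ n)

↓-+ : ∀ M k n → M ↓ (k + n) ℤ.+ (+ 2) ℤ.* (+ k) ≡ M ↓ n
↓-+ M k n = identity M (+ k) (+ n)
  where
  identity : ∀ M k n → M ℤ.- (+ 2) ℤ.* (k ℤ.+ n) ℤ.+ (+ 2) ℤ.* k ≡ M ℤ.- (+ 2) ℤ.* n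
  identity = ℤ-Solver.solve-∀

ℤ-+-cancelˡ-≤ : ∀ k {i j} → k ℤ.+ i ℤ.≤ k ℤ.+ j → i ℤ.≤ j
ℤ-+-cancelˡ-≤ k {i} {j} le =
  subst₂ ℤ._≤_ (cancel k i) (cancel k j) (ℤ.+-monoʳ-≤ (ℤ.- k) le)
  where
  cancel : ∀ k i → ℤ.- k ℤ.+ (k ℤ.+ i) ≡ i
  cancel = ℤ-Solver.solve-∀

↓-cancel-≤ : ∀ M {m n} → M ↓ m ℤ.≤ M ↓ n → n ≤ m
↓-cancel-≤ M le =
  ℤ.drop‿+≤+ (ℤ.*-cancelˡ-≤-pos _ _ (+ 2) (ℤ.neg-cancel-≤ (ℤ-+-cancelˡ-≤ M le)))

↓-mono-≥ : ∀ M {m n} → n ≤ m → M ↓ m ℤ.≤ M ↓ n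
↓-mono-≥ M n≤m =
  ℤ.+-monoʳ-≤ M (ℤ.neg-mono-≤ (ℤ.*-monoˡ-≤-nonNeg (+ 2) (ℤ.+≤+ n≤m)))

↓-injective : ∀ M {m n} → M ↓ m ≡ M ↓ n → m ≡ n
↓-injective M eq =
  ℕ.≤-antisym (↓-cancel-≤ M (ℤ.≤-reflexive (sym eq))) (↓-cancel-≤ M (ℤ.≤-reflexive eq))

-- For k > b the left-hand side exceeds M, whereas M ↓ a ≤ M.
↓+2k≤↓⇒k≤ : ∀ M a b k → M ↓ b ℤ.+ (+ 2) ℤ.* (+ k) ℤ.≤ M ↓ a → k ≤ b
↓+2k≤↓⇒k≤ M a b k le with k ≤? b
... | yes k≤b = k≤b
... | no k≰b with ℕ.m≤n⇒∃[o]m+o≡n (ℕ.≰⇒> k≰b)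
...   | j , refl = ⊥-elim (positive≰nonPositive (ℤ-+-cancelˡ-≤ M M+2[1+j]≤M↓a))
  where
  overshoot : ∀ M b j → M ℤ.- (+ 2) ℤ.* b ℤ.+ (+ 2) ℤ.* (ℤ.+ 1 ℤ.+ b ℤ.+ j)
                        ≡ M ℤ.+ (+ 2) ℤ.* (ℤ.+ 1 ℤ.+ j)
  overshoot = ℤ-Solver.solve-∀
  M+2[1+j]≤M↓a : M ℤ.+ (+ 2) ℤ.* (+ suc j) ℤ.≤ M ↓ a
  M+2[1+j]≤M↓a = subst (ℤ._≤ M ↓ a) (overshoot M (+ b) (+ j)) le
  -2a≤0 : ℤ.- ((+ 2) ℤ.* (+ a)) ℤ.≤ + 0
  -2a≤0 = ℤ.neg-mono-≤ (ℤ.*-monoˡ-≤-nonNeg (+ 2) (ℤ.+≤+ (z≤n {a})))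
  positive≰nonPositive : ¬ ((+ 2) ℤ.* (+ suc j) ℤ.≤ ℤ.- ((+ 2) ℤ.* (+ a)))
  positive≰nonPositive le with ℤ.drop‿+≤+ (ℤ.≤-trans le -2a≤0)
  ... | ()

evenInterval-↓ : ∀ M a b x →
  EvenInterval (M ↓ b) (M ↓ a) x ⇔ (∃[ n ] (a ≤ n × n ≤ b) × x ≡ M ↓ n)
evenInterval-↓ M a b x = mk⇔ to from
  where
  to : EvenInterval (M ↓ b) (M ↓ a) x → ∃[ n ] (a ≤ n × n ≤ b) × x ≡ M ↓ n
  to ((k , x≡) , x≤)
    with ℕ.m≤n⇒∃[o]m+o≡n (↓+2k≤↓⇒k≤ M a b k (subst (ℤ._≤ M ↓ a) x≡ x≤))
  ... | n , refl = n , (↓-cancel-≤ M (subst (ℤ._≤ M ↓ a) x≡M↓n x≤) , ℕ.m≤n+m n k) , x≡M↓n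
    where
    x≡M↓n : x ≡ M ↓ n
    x≡M↓n = trans x≡ (↓-+ M k n)
  from : ∃[ n ] (a ≤ n × n ≤ b) × x ≡ M ↓ n → EvenInterval (M ↓ b) (M ↓ a) x
  from (n , (a≤n , n≤b) , x≡) with ℕ.m≤n⇒∃[o]m+o≡n n≤b
  ... | k , refl = (k , x≡M↓[n+k]+2k) , subst (ℤ._≤ M ↓ a) (sym x≡) (↓-mono-≥ M a≤n)
    where
    x≡M↓[n+k]+2k : x ≡ M ↓ (n + k) ℤ.+ (+ 2) ℤ.* (+ k)
    x≡M↓[n+k]+2k = begin
      x                                  ≡⟨ x≡ ⟩
      M ↓ n                              ≡⟨ sym (↓-+ M k n) ⟩
      M ↓ (k + n) ℤ.+ (+ 2) ℤ.* (+ k)    ≡⟨ cong (λ m → M ↓ m ℤ.+ (+ 2) ℤ.* (+ k)) (ℕ.+-comm k n) ⟩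
      M ↓ (n + k) ℤ.+ (+ 2) ℤ.* (+ k)    ∎
      where open ≡-Reasoning

odd : ℕ → ℤ
odd c = (+ 2) ℤ.* (+ c) ℤ.+ (+ 1)

odd-↓ : ∀ c e → odd (c + e) ↓ e ≡ odd c
odd-↓ c e = identity (+ c) (+ e)
  where
  identity : ∀ c e → (+ 2) ℤ.* (c ℤ.+ e) ℤ.+ (+ 1) ℤ.- (+ 2) ℤ.* e ≡ (+ 2) ℤ.* c ℤ.+ (+ 1)
  identity = ℤ-Solver.solve-∀

sumSet-image : ∀ {A : Set} {S : ℤ → Set} (G : A → Set) (f : A → ℤ) →
               (∀ s → S s ⇔ (∃[ a ] G a × s ≡ f a)) →
               ∀ ℓ x → SumSet ℓ S x ⇔ (Σ[ as ∈ Vec A ℓ ] All G as × x ≡ sumV (map f as))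
sumSet-image {A} {S} G f S⇔image ℓ x = mk⇔ to from
  where
  preimage : ∀ {n} {v : Vec ℤ n} → All S v → Σ[ as ∈ Vec A n ] All G as × v ≡ map f as
  preimage [] = [] , [] , refl
  preimage (s∈S ∷ v∈S) with Equivalence.to (S⇔image _) s∈S | preimage v∈S
  ... | a , a∈G , refl | as , as∈G , refl = a ∷ as , a∈G ∷ as∈G , refl
  to : SumSet ℓ S x → Σ[ as ∈ Vec A ℓ ] All G as × x ≡ sumV (map f as)
  to (v , v∈S , refl) with preimage v∈S
  ... | as , as∈G , refl = as , as∈G , refl
  from : Σ[ as ∈ Vec A ℓ ] All G as × x ≡ sumV (map f as) → SumSet ℓ S x
  from (as , as∈G , refl) =
    map f as , map⁺ (All.map (λ a∈G → Equivalence.from (S⇔image _) (_ , a∈G , refl)) as∈G) , refl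

sumV-↓ : ∀ {n} u (es : Vec ℕ n) → sumV (map (u ↓_) es) ≡ (+ n) ℤ.* u ↓ sum es
sumV-↓ u [] = refl
sumV-↓ {suc n} u (e ∷ es) =
  trans (cong (ℤ._+_ (u ↓ e)) (sumV-↓ u es)) (identity u (+ n) (+ e) (+ sum es))
  where
  identity : ∀ u n e s → u ℤ.- (+ 2) ℤ.* e ℤ.+ (n ℤ.* u ℤ.- (+ 2) ℤ.* s)
                         ≡ (+ 1 ℤ.+ n) ℤ.* u ℤ.- (+ 2) ℤ.* (e ℤ.+ s)
  identity = ℤ-Solver.solve-∀

module _ (t : ℕ) where

  Admissible : ℕ → Set
  Admissible E = E ≡ 0 ⊎ (t + 1 < E × E ≤ 2 * t + 2) ⊎ 2 * t + 3 < E

  Forbidden : ℕ → Set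
  Forbidden E = (0 < E × E ≤ t + 1) ⊎ E ≡ 2 * t + 3

  2t+3<2t+4+ : ∀ E → 2 * t + 3 < 2 * t + 4 + E
  2t+3<2t+4+ E = <-slack E (identity t E)
    where
    identity : ∀ t E → 2 * t + 3 + suc E ≡ 2 * t + 4 + E
    identity = solve-∀

  private
    t+1≤2t+3 : t + 1 ≤ 2 * t + 3
    t+1≤2t+3 = ≤-slack (t + 2) (identity t)
      where
      identity : ∀ t → t + 1 + (t + 2) ≡ 2 * t + 3
      identity = solve-∀

  admissible⇒≡0⊎t+1< : ∀ {E} → Admissible E → E ≡ 0 ⊎ t + 1 < E
  admissible⇒≡0⊎t+1< (inj₁ E≡0) = inj₁ E≡0
  admissible⇒≡0⊎t+1< (inj₂ (inj₁ (t+1<E , _))) = inj₂ t+1<E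
  admissible⇒≡0⊎t+1< (inj₂ (inj₂ 2t+3<E)) = inj₂ (ℕ.≤-<-trans t+1≤2t+3 2t+3<E)

  admissible-+ : ∀ {E F} → Admissible E → Admissible F → Admissible (E + F)
  admissible-+ {E} {F} adm-E adm-F
    with admissible⇒≡0⊎t+1< adm-E | admissible⇒≡0⊎t+1< adm-F
  ... | inj₁ refl  | _          = adm-F
  ... | inj₂ _     | inj₁ refl  = subst Admissible (sym (ℕ.+-identityʳ E)) adm-E
  ... | inj₂ t+1<E | inj₂ t+1<F =
    inj₂ (inj₂ (subst (_≤ E + F) (identity t) (ℕ.+-mono-≤ t+1<E t+1<F)))
    where
    identity : ∀ t → suc (t + 1) + suc (t + 1) ≡ suc (2 * t + 3)
    identity = solve-∀

  forbidden-positive : ∀ {E} → Forbidden E → 0 < E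
  forbidden-positive (inj₁ (0<E , _)) = 0<E
  forbidden-positive (inj₂ refl) = ℕ.<-≤-trans (s≤s z≤n) (ℕ.m≤n+m 3 (2 * t))

  forbidden-≤ : ∀ {E} → Forbidden E → E ≤ 2 * t + 3
  forbidden-≤ (inj₁ (_ , E≤t+1)) = ℕ.≤-trans E≤t+1 t+1≤2t+3
  forbidden-≤ (inj₂ refl) = ℕ.≤-refl

  admissible⊎forbidden : ∀ E → Admissible E ⊎ Forbidden E
  admissible⊎forbidden zero = inj₁ (inj₁ refl)
  admissible⊎forbidden E@(suc _) with E ≤? t + 1 | E ≤? 2 * t + 2 | E ℕ.≟ 2 * t + 3
  ... | yes E≤t+1 | _          | _          = inj₂ (inj₁ (s≤s z≤n , E≤t+1))
  ... | no E≰t+1  | yes E≤2t+2 | _          = inj₁ (inj₂ (inj₁ (ℕ.≰⇒> E≰t+1 , E≤2t+2)))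
  ... | no _      | no _       | yes E≡2t+3 = inj₂ (inj₂ E≡2t+3)
  ... | no _      | no E≰2t+2  | no E≢2t+3  = inj₁ (inj₂ (inj₂ (ℕ.≤∧≢⇒< 2t+3≤E (E≢2t+3 ∘ sym))))
    where
    2t+3≤E : 2 * t + 3 ≤ E
    2t+3≤E = subst (_≤ E) (sym (ℕ.+-suc (2 * t) 2)) (ℕ.≰⇒> E≰2t+2)

  admissible⇒¬forbidden : ∀ {E} → Admissible E → ¬ Forbidden E
  admissible⇒¬forbidden (inj₁ refl) forb = ℕ.<-irrefl refl (forbidden-positive forb)
  admissible⇒¬forbidden (inj₂ (inj₁ (t+1<E , _))) (inj₁ (_ , E≤t+1)) = ℕ.<⇒≱ t+1<E E≤t+1
  admissible⇒¬forbidden (inj₂ (inj₁ (_ , E≤2t+2))) (inj₂ refl)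
    with ℕ.+-cancelˡ-≤ (2 * t) 3 2 E≤2t+2
  ... | s≤s (s≤s ())
  admissible⇒¬forbidden (inj₂ (inj₂ 2t+3<E)) (inj₁ (_ , E≤t+1)) =
    ℕ.<⇒≱ (ℕ.≤-<-trans t+1≤2t+3 2t+3<E) E≤t+1
  admissible⇒¬forbidden (inj₂ (inj₂ 2t+3<E)) (inj₂ refl) = ℕ.<-irrefl refl 2t+3<E

  admissible⇔¬forbidden : ∀ {E} → Admissible E ⇔ (¬ Forbidden E)
  admissible⇔¬forbidden {E} = mk⇔ admissible⇒¬forbidden ¬forbidden⇒admissible
    where
    ¬forbidden⇒admissible : ¬ Forbidden E → Admissible E
    ¬forbidden⇒admissible ¬forb with admissible⊎forbidden E
    ... | inj₁ adm = adm
    ... | inj₂ forb = ⊥-elim (¬forb forb)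

module _ (α t : ℕ) where

  Q : ℕ
  Q = α + (2 * t + 4)

  Gap : ℕ → Set
  Gap e = Admissible t e × e ≤ Q

  sum-gaps : ∀ {n} {es : Vec ℕ n} → All Gap es → Admissible t (sum es) × sum es ≤ n * Q
  sum-gaps [] = inj₁ refl , z≤n
  sum-gaps ((adm , e≤Q) ∷ gaps) with sum-gaps gaps
  ... | adm-sum , sum≤ = admissible-+ t adm adm-sum , ℕ.+-mono-≤ e≤Q sum≤

  module _ (2t+4≤α : 2 * t + 4 ≤ α) where

    private
      2t+3<α : 2 * t + 3 < α
      2t+3<α = ℕ.<-≤-trans (2t+3<2t+4+ t 0) (subst (_≤ α) (sym (ℕ.+-identityʳ _)) 2t+4≤α)

      gap-α : Gap α
      gap-α = inj₂ (inj₂ 2t+3<α) , ℕ.m≤m+n α (2 * t + 4)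

      gap-Q : Gap Q
      gap-Q = inj₂ (inj₂ (ℕ.<-≤-trans 2t+3<α (ℕ.m≤m+n α (2 * t + 4)))) , ℕ.≤-refl

      2t+4+forbidden≤Q : ∀ {E} → Forbidden t E → 2 * t + 4 + E ≤ Q
      2t+4+forbidden≤Q {E} forb = begin
        2 * t + 4 + E   ≤⟨ ℕ.+-monoʳ-≤ (2 * t + 4) (ℕ.≤-trans (forbidden-≤ t forb) (ℕ.<⇒≤ 2t+3<α)) ⟩
        2 * t + 4 + α   ≡⟨ ℕ.+-comm (2 * t + 4) α ⟩
        Q               ∎
        where open ℕ.≤-Reasoning

    decompose : ∀ n {E} → Admissible t E → E ≤ n * Q →
                Σ[ es ∈ Vec ℕ n ] All Gap es × sum es ≡ E
    decompose zero _ E≤0 = [] , [] , sym (ℕ.n≤0⇒n≡0 E≤0)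
    decompose (suc n) {E} adm E≤ with E ≤? Q
    ... | yes E≤Q with decompose n (inj₁ refl) z≤n
    ...   | es , gaps , sum≡0 =
      E ∷ es , (adm , E≤Q) ∷ gaps , trans (cong (_+_ E) sum≡0) (ℕ.+-identityʳ E)
    decompose (suc n) adm E≤ | no E≰Q with ℕ.m≤n⇒∃[o]m+o≡n (ℕ.<⇒≤ (ℕ.≰⇒> E≰Q))
    ... | E₁ , refl =
      decompose-beyond n E₁ (ℕ.+-cancelˡ-≤ Q _ _ E≤) (admissible⊎forbidden t E₁)
      where
      decompose-beyond : ∀ n E₁ → E₁ ≤ n * Q → Admissible t E₁ ⊎ Forbidden t E₁ →
                         Σ[ es ∈ Vec ℕ (suc n) ] All Gap es × sum es ≡ Q + E₁
      decompose-beyond n E₁ E₁≤ (inj₁ adm₁) with decompose n adm₁ E₁≤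
      ... | es , gaps , refl = Q ∷ es , gap-Q ∷ gaps , refl
      decompose-beyond zero E₁ E₁≤0 (inj₂ forb) =
        ⊥-elim (ℕ.<⇒≱ (forbidden-positive t forb) E₁≤0)
      decompose-beyond (suc n) E₁ _ (inj₂ forb)
        with decompose (suc n) (inj₂ (inj₂ (2t+3<2t+4+ t E₁)))
                               (ℕ.≤-trans (2t+4+forbidden≤Q forb) (ℕ.m≤m+n Q (n * Q)))
      ... | es , gaps , sum≡ =
        α ∷ es , gap-α ∷ gaps , trans (cong (_+_ α) sum≡) (identity α t E₁)
        where
        identity : ∀ α t E → α + (2 * t + 4 + E) ≡ α + (2 * t + 4) + E
        identity = solve-∀

  top : ℤ
  top = (+ 2) ℤ.* (+ α) ℤ.+ (+ 4) ℤ.* (+ t) ℤ.+ (+ 9)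

  top≡odd-Q : top ≡ odd Q
  top≡odd-Q = trans (identity (+ α) (+ t))
    (cong (λ u → (+ 2) ℤ.* (+ α ℤ.+ (u ℤ.+ (+ 4))) ℤ.+ (+ 1)) (sym (ℤ.pos-* 2 t)))
    where
    identity : ∀ a t → (+ 2) ℤ.* a ℤ.+ (+ 4) ℤ.* t ℤ.+ (+ 9)
                       ≡ (+ 2) ℤ.* (a ℤ.+ ((+ 2) ℤ.* t ℤ.+ (+ 4))) ℤ.+ (+ 1)
    identity = ℤ-Solver.solve-∀

  odd-complement : ∀ {c e} → c + e ≡ Q → odd c ≡ top ↓ e
  odd-complement {c} {e} c+e≡Q = begin
    odd c              ≡⟨ sym (odd-↓ c e) ⟩
    odd (c + e) ↓ e    ≡⟨ cong (λ q → odd q ↓ e) c+e≡Q ⟩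
    odd Q ↓ e          ≡⟨ cong (_↓ e) (sym top≡odd-Q) ⟩
    top ↓ e            ∎
    where open ≡-Reasoning

  I₂≡odd : ∀ θ → (+ 2) ℤ.* (+ α) ℤ.+ (+ 5) ℤ.+ (+ 2) ℤ.* (+ θ) ≡ odd (α + 2 + θ)
  I₂≡odd θ = identity (+ α) (+ θ)
    where
    identity : ∀ a θ → (+ 2) ℤ.* a ℤ.+ (+ 5) ℤ.+ (+ 2) ℤ.* θ
                       ≡ (+ 2) ℤ.* (a ℤ.+ (+ 2) ℤ.+ θ) ℤ.+ (+ 1)
    identity = ℤ-Solver.solve-∀

  S⁺⇒odd-complement : ∀ {s} → S⁺ α t s →
                      ∃[ c ] ∃[ e ] c + e ≡ Q × Admissible t e × s ≡ odd c
  S⁺⇒odd-complement (inj₁ (γ , γ≤α , refl)) with ℕ.m≤n⇒∃[o]m+o≡n γ≤α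
  ... | d , refl = γ , 2 * t + 4 + d , sum≡ γ d t , inj₂ (inj₂ (2t+3<2t+4+ t d)) , refl
    where
    sum≡ : ∀ γ d t → γ + (2 * t + 4 + d) ≡ γ + d + (2 * t + 4)
    sum≡ = solve-∀
  S⁺⇒odd-complement (inj₂ (inj₁ (θ , θ≤t , refl))) with ℕ.m≤n⇒∃[o]m+o≡n θ≤t
  ... | d , refl = α + 2 + θ , θ + d + 2 + d , sum≡ α θ d ,
                   inj₂ (inj₁ (<-slack d (slack θ d) , ≤-slack θ (slack′ θ d))) , I₂≡odd θ
    where
    sum≡ : ∀ α θ d → α + 2 + θ + (θ + d + 2 + d) ≡ α + (2 * (θ + d) + 4)
    sum≡ = solve-∀
    slack : ∀ θ d → θ + d + 1 + suc d ≡ θ + d + 2 + d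
    slack = solve-∀
    slack′ : ∀ θ d → θ + d + 2 + d + θ ≡ 2 * (θ + d) + 2
    slack′ = solve-∀
  S⁺⇒odd-complement (inj₂ (inj₂ refl)) = Q , 0 , ℕ.+-identityʳ Q , inj₁ refl , top≡odd-Q

  gap⇒odd-complement : ∀ {e} → Gap e → ∃[ c ] c + e ≡ Q × S⁺ α t (odd c)
  gap⇒odd-complement (inj₁ refl , _) = Q , ℕ.+-identityʳ Q , inj₂ (inj₂ (sym top≡odd-Q))
  gap⇒odd-complement (inj₂ (inj₁ (t+1<e , e≤2t+2)) , _) with ℕ.m≤n⇒∃[o]m+o≡n t+1<e
  ... | d , refl with ℕ.m≤n⇒∃[o]m+o≡n d≤t
    where
    identity : ∀ t → 2 * t + 2 ≡ suc (t + 1) + t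
    identity = solve-∀
    d≤t : d ≤ t
    d≤t = ℕ.+-cancelˡ-≤ (suc (t + 1)) d t (subst (suc (t + 1) + d ≤_) (identity t) e≤2t+2)
  ... | θ , refl = α + 2 + θ , sum≡ α d θ , inj₂ (inj₁ (θ , ℕ.m≤n+m θ d , sym (I₂≡odd θ)))
    where
    sum≡ : ∀ α d θ → α + 2 + θ + (suc (d + θ + 1) + d) ≡ α + (2 * (d + θ) + 4)
    sum≡ = solve-∀
  gap⇒odd-complement (inj₂ (inj₂ 2t+3<e) , e≤Q) with ℕ.m≤n⇒∃[o]m+o≡n 2t+3<e
  ... | d , refl with ℕ.m≤n⇒∃[o]m+o≡n d≤α
    where
    identity : ∀ α t → α + (2 * t + 4) ≡ suc (2 * t + 3) + α
    identity = solve-∀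
    d≤α : d ≤ α
    d≤α = ℕ.+-cancelˡ-≤ (suc (2 * t + 3)) d α (subst (suc (2 * t + 3) + d ≤_) (identity α t) e≤Q)
  ... | γ , refl = γ , sum≡ d γ t , inj₁ (γ , ℕ.m≤n+m γ d , refl)
    where
    sum≡ : ∀ d γ t → γ + (suc (2 * t + 3) + d) ≡ d + γ + (2 * t + 4)
    sum≡ = solve-∀

  S⁺⇔gap : ∀ s → S⁺ α t s ⇔ (∃[ e ] Gap e × s ≡ top ↓ e)
  S⁺⇔gap s = mk⇔ to from
    where
    to : S⁺ α t s → ∃[ e ] Gap e × s ≡ top ↓ e
    to s∈S⁺ with S⁺⇒odd-complement s∈S⁺
    ... | c , e , c+e≡Q , adm , refl =
      e , (adm , ≤-slack c (trans (ℕ.+-comm e c) c+e≡Q)) , odd-complement {c} {e} c+e≡Q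
    from : ∃[ e ] Gap e × s ≡ top ↓ e → S⁺ α t s
    from (e , gap , refl) with gap⇒odd-complement gap
    ... | c , c+e≡Q , odd-c∈S⁺ = subst (S⁺ α t) (odd-complement {c} {e} c+e≡Q) odd-c∈S⁺

  sumSet⇔admissible-deficit : 2 * t + 4 ≤ α → ∀ ℓ x →
    SumSet ℓ (S⁺ α t) x ⇔ (∃[ E ] (Admissible t E × E ≤ ℓ * Q) × x ≡ Mval ℓ α t ↓ E)
  sumSet⇔admissible-deficit 2t+4≤α ℓ x = mk⇔ to from
    where
    gap-sums : SumSet ℓ (S⁺ α t) x ⇔
               (Σ[ es ∈ Vec ℕ ℓ ] All Gap es × x ≡ sumV (map (top ↓_) es))
    gap-sums = sumSet-image Gap (top ↓_) S⁺⇔gap ℓ x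
    to : SumSet ℓ (S⁺ α t) x → ∃[ E ] (Admissible t E × E ≤ ℓ * Q) × x ≡ Mval ℓ α t ↓ E
    to x∈ℓS⁺ =
      let es , gaps , x≡ = Equivalence.to gap-sums x∈ℓS⁺
      in sum es , sum-gaps gaps , trans x≡ (sumV-↓ top es)
    from : ∃[ E ] (Admissible t E × E ≤ ℓ * Q) × x ≡ Mval ℓ α t ↓ E → SumSet ℓ (S⁺ α t) x
    from (E , (adm , E≤) , x≡) with decompose 2t+4≤α ℓ adm E≤
    ... | es , gaps , refl =
      Equivalence.from gap-sums (es , gaps , trans x≡ (sym (sumV-↓ top es)))

  module _ (ℓ : ℕ) where

    M : ℤ
    M = Mval ℓ α t

    Excluded : ℤ → Set
    Excluded x = EvenInterval (M ℤ.- (+ 2) ℤ.* (+ t) ℤ.- (+ 2)) (M ℤ.- (+ 2)) x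
               ⊎ x ≡ M ℤ.- (+ 4) ℤ.* (+ t) ℤ.- (+ 6)

    private
      ℓ≡M↓ℓQ : + ℓ ≡ M ↓ (ℓ * Q)
      ℓ≡M↓ℓQ = begin
        + ℓ                                               ≡⟨ identity (+ ℓ) (+ Q) ⟩
        (+ ℓ) ℤ.* odd Q ℤ.- (+ 2) ℤ.* ((+ ℓ) ℤ.* (+ Q))   ≡⟨ cong₂ (λ u v → (+ ℓ) ℤ.* u ℤ.- (+ 2) ℤ.* v)
                                                                   (sym top≡odd-Q) (sym (ℤ.pos-* ℓ Q)) ⟩
        M ↓ (ℓ * Q)                                       ∎
        where
        open ≡-Reasoning
        identity : ∀ l q → l ≡ l ℤ.* ((+ 2) ℤ.* q ℤ.+ (+ 1)) ℤ.- (+ 2) ℤ.* (l ℤ.* q)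
        identity = ℤ-Solver.solve-∀

      M≡M↓0 : M ≡ M ↓ 0
      M≡M↓0 = sym (ℤ.+-identityʳ M)

      lower≡ : M ℤ.- (+ 2) ℤ.* (+ t) ℤ.- (+ 2) ≡ M ↓ (t + 1)
      lower≡ = identity M (+ t)
        where
        identity : ∀ M t → M ℤ.- (+ 2) ℤ.* t ℤ.- (+ 2) ≡ M ℤ.- (+ 2) ℤ.* (t ℤ.+ (+ 1))
        identity = ℤ-Solver.solve-∀

      singleton≡ : M ℤ.- (+ 4) ℤ.* (+ t) ℤ.- (+ 6) ≡ M ↓ (2 * t + 3)
      singleton≡ = trans (identity M (+ t))
        (cong (λ u → M ℤ.- (+ 2) ℤ.* (u ℤ.+ (+ 3))) (sym (ℤ.pos-* 2 t)))
        where
        identity : ∀ M t → M ℤ.- (+ 4) ℤ.* t ℤ.- (+ 6)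
                           ≡ M ℤ.- (+ 2) ℤ.* ((+ 2) ℤ.* t ℤ.+ (+ 3))
        identity = ℤ-Solver.solve-∀

    evenInterval⇔deficit : ∀ x → EvenInterval (+ ℓ) M x ⇔ (∃[ E ] E ≤ ℓ * Q × x ≡ M ↓ E)
    evenInterval⇔deficit x = mk⇔ to from
      where
      interval : EvenInterval (M ↓ (ℓ * Q)) (M ↓ 0) x ⇔
                 (∃[ E ] (0 ≤ E × E ≤ ℓ * Q) × x ≡ M ↓ E)
      interval = evenInterval-↓ M 0 (ℓ * Q) x
      to : EvenInterval (+ ℓ) M x → ∃[ E ] E ≤ ℓ * Q × x ≡ M ↓ E
      to x∈ = let E , (_ , E≤) , x≡ = Equivalence.to interval (reindex x∈) in E , E≤ , x≡
        where
        reindex : EvenInterval (+ ℓ) M x → EvenInterval (M ↓ (ℓ * Q)) (M ↓ 0) x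
        reindex = subst₂ (λ a b → EvenInterval a b x) ℓ≡M↓ℓQ M≡M↓0
      from : ∃[ E ] E ≤ ℓ * Q × x ≡ M ↓ E → EvenInterval (+ ℓ) M x
      from (E , E≤ , x≡) = subst₂ (λ a b → EvenInterval a b x) (sym ℓ≡M↓ℓQ) (sym M≡M↓0)
                                  (Equivalence.from interval (E , (z≤n , E≤) , x≡))

    excluded⇔forbidden : ∀ {x E} → x ≡ M ↓ E → Excluded x ⇔ Forbidden t E
    excluded⇔forbidden {x} {E} x≡ = mk⇔ to from
      where
      interval : EvenInterval (M ↓ (t + 1)) (M ↓ 1) x ⇔
                 (∃[ E ] (1 ≤ E × E ≤ t + 1) × x ≡ M ↓ E)
      interval = evenInterval-↓ M 1 (t + 1) x
      to : Excluded x → Forbidden t E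
      to (inj₁ x∈) =
        let n , n∈ , x≡′ =
              Equivalence.to interval (subst (λ a → EvenInterval a (M ↓ 1) x) lower≡ x∈)
        in inj₁ (subst (λ m → 0 < m × m ≤ t + 1) (↓-injective M {n} {E} (trans (sym x≡′) x≡)) n∈)
      to (inj₂ x≡′) = inj₂ (↓-injective M {E} {2 * t + 3} (trans (sym x≡) (trans x≡′ singleton≡)))
      from : Forbidden t E → Excluded x
      from (inj₁ E∈) = inj₁ (subst (λ a → EvenInterval a (M ↓ 1) x) (sym lower≡)
                                   (Equivalence.from interval (E , E∈ , x≡)))
      from (inj₂ refl) = inj₂ (trans x≡ (sym singleton≡))

    target⇔non-forbidden-deficit : ∀ x →
      Target ℓ α t x ⇔ (∃[ E ] (¬ Forbidden t E × E ≤ ℓ * Q) × x ≡ M ↓ E)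
    target⇔non-forbidden-deficit x = mk⇔ to from
      where
      to : Target ℓ α t x → ∃[ E ] (¬ Forbidden t E × E ≤ ℓ * Q) × x ≡ M ↓ E
      to (x∈ , x∉) =
        let E , E≤ , x≡ = Equivalence.to (evenInterval⇔deficit x) x∈
        in E , (x∉ ∘ Equivalence.from (excluded⇔forbidden x≡) , E≤) , x≡
      from : ∃[ E ] (¬ Forbidden t E × E ≤ ℓ * Q) × x ≡ M ↓ E → Target ℓ α t x
      from (E , (¬forb , E≤) , x≡) =
        Equivalence.from (evenInterval⇔deficit x) (E , E≤ , x≡) ,
        ¬forb ∘ Equivalence.to (excluded⇔forbidden x≡)

2t+4≤α : ∀ ℓ α t → 4 ≤ ℓ → 2 * t + 2 * ℓ ∸ 2 ≤ α → 2 * t + 4 ≤ α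
2t+4≤α ℓ α t 4≤ℓ α-large = ℕ.≤-trans (ℕ.m+n≤o⇒m≤o∸n (2 * t + 4) 2t+6≤2t+2ℓ) α-large
  where
  identity : ∀ t → 2 * t + 4 + 2 + 2 ≡ 2 * t + 2 * 4
  identity = solve-∀
  2t+6≤2t+2ℓ : 2 * t + 4 + 2 ≤ 2 * t + 2 * ℓ
  2t+6≤2t+2ℓ = ℕ.≤-trans (≤-slack 2 (identity t)) (ℕ.+-monoʳ-≤ (2 * t) (ℕ.*-monoʳ-≤ 2 4≤ℓ))

lemma2p1 : (ℓ α t : ℕ) → 4 ≤ ℓ → 2 ∣ ℓ → 1 ≤ α → 1 ≤ t →
           2 * t + 2 * ℓ ∸ 2 ≤ α →
           (x : ℤ) → SumSet ℓ (S⁺ α t) x ⇔ Target ℓ α t x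
lemma2p1 ℓ α t 4≤ℓ _ _ _ α-large x = mk⇔
  (λ x∈ℓS⁺ → let E , (adm , E≤) , x≡ = Equivalence.to sumSet⇔ x∈ℓS⁺ in
     Equivalence.from target⇔ (E , (Equivalence.to (admissible⇔¬forbidden t) adm , E≤) , x≡))
  (λ x∈target → let E , (¬forb , E≤) , x≡ = Equivalence.to target⇔ x∈target in
     Equivalence.from sumSet⇔ (E , (Equivalence.from (admissible⇔¬forbidden t) ¬forb , E≤) , x≡))
  where
  sumSet⇔ : SumSet ℓ (S⁺ α t) x ⇔ (∃[ E ] (Admissible t E × E ≤ ℓ * Q α t) × x ≡ M α t ℓ ↓ E)
  sumSet⇔ = sumSet⇔admissible-deficit α t (2t+4≤α ℓ α t 4≤ℓ α-large) ℓ x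
  target⇔ : Target ℓ α t x ⇔ (∃[ E ] (¬ Forbidden t E × E ≤ ℓ * Q α t) × x ≡ M α t ℓ ↓ E)
  target⇔ = target⇔non-forbidden-deficit α t ℓ x
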